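{- Let $G$ be a connected distance-hereditary graph. Then $G$ is twin-free if and only if $G$ is prime.
   Context: A graph is distance-hereditary if it contains no induced hole (cycle of length at least $5$), house ($4$-cycle plus a vertex adjacent to exactly two adjacent vertices of the cycle), domino (two $4$-cycles sharing an edge), or gem ($P_4$ plus a vertex adjacent to all its vertices). Two distinct vertices $u,v$ are twins if $N(u)\setminus\{u,v\}=N(v)\setminus\{u,v\}$; $G$ is twin-free if it has no pair of twins. A module of $G=(V,E)$ is a set $M\subseteq V$ such that each vertex outside $M$ is adjacent to all or none of $M$; it is trivial if $|M|\le1$ or $M=V$; $G$ is prime if all its modules are trivial. -}

module Defs where

open import Data.Nat using (ℕ; zero; suc; _≤_; _≡ᵇ_; _%_)
open import Data.Bool using (Bool; true; false; _∧_; _∨_)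
open import Data.Fin using (Fin; toℕ)
open import Data.Fin.Subset using (Subset; _∈_; _∉_; ∣_∣; ⊤)
open import Data.List using (List; []; _∷_)
open import Data.Bool.ListAction using (any)
open import Data.Product using (Σ; _×_; _,_)
open import Data.Sum using (_⊎_)
open import Relation.Nullary using (¬_)
open import Relation.Binary.PropositionalEquality using (_≡_; _≢_)
open import Relation.Binary.Construct.Closure.ReflexiveTransitive using (Star)
open import Function.Definitions using (Injective)

record Graph : Set where
  field
    n      : ℕ
    adj    : Fin n → Fin n → Bool
    sym    : ∀ i j → adj i j ≡ adj j i
    irrefl : ∀ i → adj i i ≡ false
open Graph public

ContainsInduced : (G : Graph) (k : ℕ) → (Fin k → Fin k → Bool) → Set
ContainsInduced G k H =
  Σ (Fin k → Fin (n G)) λ f →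
    Injective _≡_ _≡_ f × (∀ i j → adj G (f i) (f j) ≡ H i j)

fromEdges : ∀ {k} → List (ℕ × ℕ) → Fin k → Fin k → Bool
fromEdges es i j = any (λ { (a , b) →
    ((toℕ i ≡ᵇ a) ∧ (toℕ j ≡ᵇ b)) ∨ ((toℕ i ≡ᵇ b) ∧ (toℕ j ≡ᵇ a)) }) es

holeAdj : (m : ℕ) → Fin (5 Data.Nat.+ m) → Fin (5 Data.Nat.+ m) → Bool
holeAdj m i j = (toℕ j ≡ᵇ (suc (toℕ i) % (5 Data.Nat.+ m)))
              ∨ (toℕ i ≡ᵇ (suc (toℕ j) % (5 Data.Nat.+ m)))

-- House: 4-cycle 0-1-2-3-0 plus vertex 4 adjacent to 0 and 1.
houseAdj : Fin 5 → Fin 5 → Bool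
houseAdj = fromEdges ((0 , 1) ∷ (1 , 2) ∷ (2 , 3) ∷ (3 , 0) ∷ (4 , 0) ∷ (4 , 1) ∷ [])

-- Domino: 4-cycles 0-1-4-3-0 and 1-2-5-4-1 sharing edge 1-4.
dominoAdj : Fin 6 → Fin 6 → Bool
dominoAdj = fromEdges ((0 , 1) ∷ (1 , 2) ∷ (3 , 4) ∷ (4 , 5) ∷ (0 , 3) ∷ (1 , 4) ∷ (2 , 5) ∷ [])

-- Gem: path 0-1-2-3 plus vertex 4 adjacent to all of 0,1,2,3.
gemAdj : Fin 5 → Fin 5 → Bool
gemAdj = fromEdges ((0 , 1) ∷ (1 , 2) ∷ (2 , 3) ∷ (4 , 0) ∷ (4 , 1) ∷ (4 , 2) ∷ (4 , 3) ∷ [])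

DistanceHereditary : Graph → Set
DistanceHereditary G =
  (∀ m → ¬ ContainsInduced G (5 Data.Nat.+ m) (holeAdj m))
  × ¬ ContainsInduced G 5 houseAdj
  × ¬ ContainsInduced G 6 dominoAdj
  × ¬ ContainsInduced G 5 gemAdj

Connected : Graph → Set
Connected G = ∀ u v → Star (λ x y → adj G x y ≡ true) u v

Twins : (G : Graph) → Fin (n G) → Fin (n G) → Set
Twins G u v = u ≢ v × (∀ w → w ≢ u → w ≢ v → adj G u w ≡ adj G v w)

TwinFree : Graph → Set
TwinFree G = ∀ u v → ¬ Twins G u v

IsModule : (G : Graph) → Subset (n G) → Set
IsModule G M = ∀ x → x ∉ M →
  (∀ y → y ∈ M → adj G x y ≡ true) ⊎ (∀ y → y ∈ M → adj G x y ≡ false)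

TrivialModule : (G : Graph) → Subset (n G) → Set
TrivialModule G M = ∣ M ∣ ≤ 1 ⊎ M ≡ ⊤

Prime : Graph → Set
Prime G = ∀ M → IsModule G M → TrivialModule G M

{-# OPTIONS --safe #-}
-- A module M with at least two vertices and a vertex z outside it is entered, on a path from z,
-- by an edge x – y; as M is a module, x is adjacent to all of M, so an induced P₄ inside M would
-- form a gem with x: G[M] is P₄-free. A P₄-free graph on at least two vertices has twins, because
-- it or its complement is disconnected (Seinsche): twins are found by recursing into a side with
-- two vertices, or are the two sides themselves. The cut is built one vertex at a time: a new
-- vertex v joins a side if it has the cut's adjacency towards all of the other side; otherwise
-- P₄-freeness forces the cut by adjacency to v. Since every vertex outside M sees all or none of M,
-- twins of G[M] are twins of G. Conversely, twins u, v form the module {u, v}, which is nontrivial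
-- once G has a third vertex.
module Submission where

open import Defs
open import Data.Bool using (Bool; true; false; not)
open import Data.Bool.Properties using (¬-not) renaming (_≟_ to _≟ᵇ_)
open import Data.Empty using (⊥; ⊥-elim)
open import Data.Fin using (Fin; zero; suc)
open import Data.Fin.Patterns using (0F; 1F; 2F; 3F; 4F)
open import Data.Fin.Properties using (_≟_; suc-injective; any?; all?)
open import Data.Vec.Base using ([]; _∷_; here; there)
open import Data.Fin.Subset using (Subset; inside; outside; ⁅_⁆; _∪_; _⊂_; ⊤; ∣_∣; Nonempty)
open import Data.Fin.Subset.Properties
  using (_∈?_; ∣⊤∣≡n; ∣⁅x⁆∣≡1; ∣p∣≤∣x∷p∣; x∈⁅x⁆; x∈⁅y⁆⇒x≡y; x≢y⇒x∉⁅y⁆; x∈p∪q⁺; x∈p∪q⁻;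
         p⊆p∪q; p⊂q⇒∣p∣<∣q∣; ⊆-antisym; ⊆⊤)
open import Data.List using (List; []; _∷_; length; filter; allFin)
open import Data.List.Properties using (filter-notAll)
open import Data.List.Membership.Propositional.Properties using (∈-filter⁺; ∈-filter⁻; ∈-allFin)
open import Data.List.Relation.Unary.Any using (Any; here; there)
import Data.List.Relation.Unary.Any as Any
open import Data.List.Relation.Unary.All using (All)
import Data.List.Relation.Unary.All as All
open import Data.List.Relation.Unary.Unique.Propositional using (Unique; _∷_)
open import Data.List.Relation.Unary.Unique.Propositional.Properties using (filter⁺; allFin⁺)
open import Data.Nat using (_+_; _≤_; _<_; z≤n; s≤s; _≤?_)
open import Data.Nat.Induction using (<-wellFounded)
open import Data.Nat.Properties using (≤-pred; ≤-trans; ≤-reflexive; +-suc; +-monoʳ-≤; <⇒≱; ≰⇒>; module ≤-Reasoning)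
open import Data.Product using (_×_; _,_; proj₁; proj₂; ∃; ∃₂)
open import Data.Sum using (_⊎_; inj₁; inj₂)
open import Data.Unit using (tt)
open import Function using (_∘_)
open import Function.Bundles using (_⇔_; mk⇔)
open import Function.Definitions using (Injective)
open import Induction.WellFounded using (Acc; acc)
open import Level using (0ℓ)
open import Relation.Binary.Construct.Closure.ReflexiveTransitive using (Star; ε; _◅_)
open import Relation.Binary.PropositionalEquality using (_≡_; _≢_; refl; trans; cong; cong₂; subst)
import Relation.Binary.PropositionalEquality as ≡
open import Relation.Nullary using (¬_; Dec; yes; no; ¬?)
open import Relation.Nullary.Decidable using (_×-dec_; _→-dec_; decidable-stable; from-yes)
open import Relation.Unary using (Pred; Decidable; ∁; U; _⊆_)
open import Relation.Unary.Properties using (∁?; U?)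

module _ (G : Graph) where

  open import Data.List.Membership.Propositional using (_∈_; find; lose)

  private
    V : Set
    V = Fin (n G)

  -- An induced path a – b – c – d of G (k = false) or of its complement (k = true).
  P₄ : Bool → V → V → V → V → Set
  P₄ k a b c d = adj G a b ≡ not k × adj G b c ≡ not k × adj G c d ≡ not k
               × adj G a c ≡ k × adj G b d ≡ k × adj G a d ≡ k

  P₄-complement : ∀ {a b c d} → P₄ true a b c d → P₄ false c a d b
  P₄-complement {a} {b} {c} {d} (ab , bc , cd , ac , bd , ad) =
    trans (sym G c a) ac , ad , trans (sym G d b) bd , cd , ab , trans (sym G c b) bc

  P₄Free : Pred V 0ℓ → Set
  P₄Free P = ∀ {a b c d} → P a → P b → P c → P d → ¬ P₄ false a b c d

  P₄Free-⊆ : ∀ {P Q} → P ⊆ Q → P₄Free Q → P₄Free P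
  P₄Free-⊆ P⊆Q free a b c d = free (P⊆Q a) (P⊆Q b) (P⊆Q c) (P⊆Q d)

  P₄Free⇒¬P₄ : ∀ {P} → P₄Free P → ∀ k {a b c d} → P a → P b → P c → P d → ¬ P₄ k a b c d
  P₄Free⇒¬P₄ free false Pa Pb Pc Pd = free Pa Pb Pc Pd
  P₄Free⇒¬P₄ free true  Pa Pb Pc Pd = free Pc Pa Pd Pb ∘ P₄-complement

  TwinsIn : Pred V 0ℓ → V → V → Set
  TwinsIn P u w = u ≢ w × (∀ {x} → P x → x ≢ u → x ≢ w → adj G u x ≡ adj G w x)

  HasTwins : Pred V 0ℓ → Set
  HasTwins P = ∃₂ λ u w → P u × P w × TwinsIn P u w

  HasTwins-≐ : ∀ {P Q} → P ⊆ Q → Q ⊆ P → HasTwins P → HasTwins Q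
  HasTwins-≐ P⊆Q Q⊆P (u , w , Pu , Pw , u≢w , same) =
    u , w , P⊆Q Pu , P⊆Q Pw , u≢w , same ∘ Q⊆P

  ∈-length≤1 : ∀ {T : List V} {x y} → length T ≤ 1 → x ∈ T → y ∈ T → x ≡ y
  ∈-length≤1 {_ ∷ []}    _         (here refl) (here refl) = refl
  ∈-length≤1 {_ ∷ _ ∷ _} (s≤s ()) _           _

  Uniform : List V → Pred V 0ℓ → Bool → Set
  Uniform S L k = ∀ {a b} → a ∈ S → b ∈ S → L a → ¬ L b → adj G a b ≡ k

  -- G[S] (colour = false) or its complement (colour = true) is disconnected.
  record UniformCut (S : List V) : Set₁ where
    field
      Left      : Pred V 0ℓ
      left?     : Decidable Left
      colour    : Bool
      leftElem  : ∃ λ a → a ∈ S × Left a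
      rightElem : ∃ λ b → b ∈ S × ¬ Left b
      uniform   : Uniform S Left colour

  open UniformCut

  swapSides : ∀ {S} → UniformCut S → UniformCut S
  swapSides cut = record
    { Left      = ∁ (Left cut)
    ; left?     = ∁? (left? cut)
    ; colour    = colour cut
    ; leftElem  = rightElem cut
    ; rightElem = let a , a∈ , La = leftElem cut in a , a∈ , λ ¬La → ¬La La
    ; uniform   = λ {a} {b} a∈ b∈ ¬La ¬¬Lb →
        trans (sym G a b) (uniform cut b∈ a∈ (decidable-stable (left? cut b) ¬¬Lb) ¬La)
    }

  insertRight : ∀ {v S} → All (v ≢_) S → (L : Pred V 0ℓ) → Decidable L → (k : Bool) →
                Uniform S L k → (∀ {a} → a ∈ S → L a → adj G a v ≡ k) →
                ∃ (λ a → a ∈ S × L a) → UniformCut (v ∷ S)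
  insertRight {v} {S} v∉S L L? k uniformS toV (a , a∈ , La) = record
    { Left      = L′
    ; left?     = λ w → L? w ×-dec ¬? (w ≟ v)
    ; colour    = k
    ; leftElem  = a , there a∈ , La , ≢v a∈
    ; rightElem = v , here refl , λ (_ , v≢v) → v≢v refl
    ; uniform   = uniform′
    }
    where
    L′ : Pred V 0ℓ
    L′ w = L w × w ≢ v

    ≢v : ∀ {w} → w ∈ S → w ≢ v
    ≢v w∈ w≡v = All.lookup v∉S w∈ (≡.sym w≡v)

    uniform′ : Uniform (v ∷ S) L′ k
    uniform′ (here refl) _           (_ , v≢v) _    = ⊥-elim (v≢v refl)
    uniform′ (there a∈)  (here refl) (La , _)  _    = toV a∈ La
    uniform′ (there a∈)  (there b∈)  (La , _)  ¬L′b = uniformS a∈ b∈ La (λ Lb → ¬L′b (Lb , ≢v b∈))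

  isolate : ∀ {v S a k} → All (v ≢_) S → a ∈ S → (∀ {b} → b ∈ S → adj G b v ≡ k) → UniformCut (v ∷ S)
  isolate v∉S a∈ toV =
    insertRight v∉S U U? _ (λ _ _ _ ¬Ub → ⊥-elim (¬Ub tt)) (λ b∈ _ → toV b∈) (_ , a∈ , tt)

  Crossing : ∀ {S} → V → UniformCut S → Set
  Crossing {S} v cut = Any (λ a → Left cut a × adj G a v ≢ colour cut) S

  crossing? : ∀ {S} v (cut : UniformCut S) → Dec (Crossing v cut)
  crossing? v cut = Any.any? (λ a → left? cut a ×-dec ¬? (adj G a v ≟ᵇ colour cut)) _

  ¬Crossing⇒uniform : ∀ {S v} (cut : UniformCut S) → ¬ Crossing v cut →
                      ∀ {a} → a ∈ S → Left cut a → adj G a v ≡ colour cut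
  ¬Crossing⇒uniform {v = v} cut ¬cross {a} a∈ La =
    decidable-stable (adj G a v ≟ᵇ colour cut) (λ av≢ → ¬cross (lose a∈ (La , av≢)))

  sameSideAcross : ∀ {v S} (cut : UniformCut S) → P₄Free (_∈ v ∷ S) →
                   ∀ {b x z} → b ∈ S → ¬ Left cut b → adj G b v ≢ colour cut →
                   x ∈ S → z ∈ S → Left cut x → Left cut z →
                   adj G x v ≡ colour cut → adj G z v ≢ colour cut → adj G x z ≡ colour cut
  sameSideAcross {v} cut free {b} {x} {z} b∈ ¬Lb bv x∈ z∈ Lx Lz xv zv =
    decidable-stable (adj G x z ≟ᵇ colour cut) λ xz →
      P₄Free⇒¬P₄ free (colour cut) (there b∈) (here refl) (there z∈) (there x∈)
        ( ¬-not bv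
        , trans (sym G v z) (¬-not zv)
        , trans (sym G z x) (¬-not xz)
        , trans (sym G b z) (uniform cut z∈ b∈ Lz ¬Lb)
        , trans (sym G v x) xv
        , trans (sym G b x) (uniform cut x∈ b∈ Lx ¬Lb)
        )

  neighbourhoodUniform : ∀ {v S} (cut : UniformCut S) → P₄Free (_∈ v ∷ S) →
                         Crossing v cut → Crossing v (swapSides cut) →
                         Uniform S (λ w → adj G w v ≡ colour cut) (colour cut)
  neighbourhoodUniform cut free a₁ b₁ {x} {z} x∈ z∈ xv zv with left? cut x | left? cut z
  ... | yes Lx | no ¬Lz = uniform cut x∈ z∈ Lx ¬Lz
  ... | no ¬Lx | yes Lz = trans (sym G x z) (uniform cut z∈ x∈ Lz ¬Lx)
  ... | yes Lx | yes Lz =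
    let b , b∈ , ¬Lb , bv = find b₁ in
    sameSideAcross cut free b∈ ¬Lb bv x∈ z∈ Lx Lz xv zv
  ... | no ¬Lx | no ¬Lz =
    let a , a∈ , La , av = find a₁ in
    sameSideAcross (swapSides cut) free a∈ (λ ¬La → ¬La La) av x∈ z∈ ¬Lx ¬Lz xv zv

  neighbourhoodCut : ∀ {v S} → All (v ≢_) S → P₄Free (_∈ v ∷ S) → (cut : UniformCut S) →
                     Crossing v cut → Crossing v (swapSides cut) → UniformCut (v ∷ S)
  neighbourhoodCut {v} {S} v∉S free cut a₁ b₁ with Any.any? (λ y → adj G y v ≟ᵇ colour cut) S
  ... | no ¬y =
    let _ , a∈ , _ = find a₁ in
    isolate v∉S a∈ (λ b∈ → ¬-not (λ bv → ¬y (lose b∈ bv)))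
  ... | yes y =
    insertRight v∉S (λ w → adj G w v ≡ colour cut) (λ w → adj G w v ≟ᵇ colour cut) (colour cut)
      (neighbourhoodUniform cut free a₁ b₁) (λ _ wv → wv) (find y)

  joinRight : ∀ {v S} → All (v ≢_) S → (cut : UniformCut S) → ¬ Crossing v cut → UniformCut (v ∷ S)
  joinRight v∉S cut ¬cross = insertRight v∉S (Left cut) (left? cut) (colour cut) (uniform cut)
                               (¬Crossing⇒uniform cut ¬cross) (leftElem cut)

  extendCut : ∀ {v S} → All (v ≢_) S → P₄Free (_∈ v ∷ S) → UniformCut S → UniformCut (v ∷ S)
  extendCut {v} v∉S free cut with crossing? v cut | crossing? v (swapSides cut)
  ... | no ¬a  | _      = joinRight v∉S cut ¬a
  ... | _      | no ¬b  = joinRight v∉S (swapSides cut) ¬b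
  ... | yes a₁ | yes b₁ = neighbourhoodCut v∉S free cut a₁ b₁

  uniformCut : ∀ {S} → Unique S → P₄Free (_∈ S) → 2 ≤ length S → UniformCut S
  uniformCut {_ ∷ []} _ _ (s≤s ())
  uniformCut {v ∷ y ∷ []} (v∉ ∷ _) _ _ =
    isolate v∉ (here refl) λ { (here refl) → refl ; (there ()) }
  uniformCut {v ∷ S@(_ ∷ _ ∷ _)} (v∉S ∷ uniqueS) free _ =
    extendCut v∉S free (uniformCut uniqueS (P₄Free-⊆ there free) (s≤s (s≤s z≤n)))

  ShorterHaveTwins : List V → Set
  ShorterHaveTwins S =
    ∀ {T} → length T < length S → Unique T → P₄Free (_∈ T) → 2 ≤ length T → HasTwins (_∈ T)

  leftTwins⇒twins : ∀ {S} (cut : UniformCut S) → HasTwins (_∈ filter (left? cut) S) → HasTwins (_∈ S)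
  leftTwins⇒twins {S} cut (u , w , u∈L , w∈L , u≢w , same) =
    u , w , proj₁ (inL u∈L) , proj₁ (inL w∈L) , u≢w , same′
    where
    inL : ∀ {x} → x ∈ filter (left? cut) S → x ∈ S × Left cut x
    inL = ∈-filter⁻ (left? cut) {xs = S}

    uniformFromLeft : ∀ {y x} → y ∈ filter (left? cut) S → x ∈ S → ¬ Left cut x → adj G y x ≡ colour cut
    uniformFromLeft y∈L x∈ ¬Lx = uniform cut (proj₁ (inL y∈L)) x∈ (proj₂ (inL y∈L)) ¬Lx

    same′ : ∀ {x} → x ∈ S → x ≢ u → x ≢ w → adj G u x ≡ adj G w x
    same′ {x} x∈ with left? cut x
    ... | yes Lx = same (∈-filter⁺ (left? cut) x∈ Lx)
    ... | no ¬Lx = λ _ _ → trans (uniformFromLeft u∈L x∈ ¬Lx) (≡.sym (uniformFromLeft w∈L x∈ ¬Lx))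

  leftTwins : ∀ {S} (cut : UniformCut S) → Unique S → P₄Free (_∈ S) →
              ShorterHaveTwins S →
              2 ≤ length (filter (left? cut) S) → HasTwins (_∈ S)
  leftTwins {S} cut uniqueS free rec 2≤L =
    leftTwins⇒twins cut (rec shorter (filter⁺ (left? cut) uniqueS) (P₄Free-⊆ L⊆S free) 2≤L)
    where
    L⊆S : (_∈ filter (left? cut) S) ⊆ (_∈ S)
    L⊆S = proj₁ ∘ ∈-filter⁻ (left? cut) {xs = S}

    shorter : length (filter (left? cut) S) < length S
    shorter = let b , b∈ , ¬Lb = rightElem cut in filter-notAll (left? cut) S (lose b∈ ¬Lb)

  singletonSides⇒twins : ∀ {S} (cut : UniformCut S) →
                         length (filter (left? cut) S) ≤ 1 → length (filter (left? (swapSides cut)) S) ≤ 1 →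
                         HasTwins (_∈ S)
  singletonSides⇒twins {S} cut@record { leftElem = a , a∈ , La ; rightElem = b , b∈ , ¬Lb } L≤1 R≤1 =
    a , b , a∈ , b∈ , a≢b , λ x∈ x≢a x≢b → ⊥-elim (onNeither x∈ x≢a x≢b)
    where
    a≢b : a ≢ b
    a≢b refl = ¬Lb La

    onNeither : ∀ {x} → x ∈ S → x ≢ a → x ≢ b → ⊥
    onNeither {x} x∈ x≢a x≢b with left? cut x
    ... | yes Lx = x≢a (∈-length≤1 L≤1 (∈-filter⁺ (left? cut) x∈ Lx) (∈-filter⁺ (left? cut) a∈ La))
    ... | no ¬Lx = x≢b (∈-length≤1 R≤1 (∈-filter⁺ (∁? (left? cut)) x∈ ¬Lx) (∈-filter⁺ (∁? (left? cut)) b∈ ¬Lb))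

  twinsFromCut : ∀ {S} (cut : UniformCut S) → Unique S → P₄Free (_∈ S) →
                 ShorterHaveTwins S →
                 HasTwins (_∈ S)
  twinsFromCut {S} cut uniqueS free rec
    with 2 ≤? length (filter (left? cut) S) | 2 ≤? length (filter (left? (swapSides cut)) S)
  ... | yes 2≤L | _       = leftTwins cut uniqueS free rec 2≤L
  ... | _       | yes 2≤R = leftTwins (swapSides cut) uniqueS free rec 2≤R
  ... | no L≰   | no R≰   = singletonSides⇒twins cut (≤-pred (≰⇒> L≰)) (≤-pred (≰⇒> R≰))

  uniqueP₄Free⇒twins : ∀ {S} → Unique S → P₄Free (_∈ S) → 2 ≤ length S → HasTwins (_∈ S)
  uniqueP₄Free⇒twins {S} = go (<-wellFounded (length S))
    where
    go : ∀ {S} → Acc _<_ (length S) → Unique S → P₄Free (_∈ S) → 2 ≤ length S → HasTwins (_∈ S)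
    go (acc rec) uniqueS free 2≤S =
      twinsFromCut (uniformCut uniqueS free 2≤S) uniqueS free (λ shorter → go (rec shorter))

  P₄Free⇒twins : ∀ {P} → Decidable P → P₄Free P → ∀ {u₀ u₁} → P u₀ → P u₁ → u₀ ≢ u₁ → HasTwins P
  P₄Free⇒twins {P} P? free Pu₀ Pu₁ u₀≢u₁ =
    HasTwins-≐ fromList toList (uniqueP₄Free⇒twins (filter⁺ P? (allFin⁺ (n G))) (P₄Free-⊆ fromList free) atLeastTwo)
    where
    S = filter P? (allFin (n G))

    toList : P ⊆ (_∈ S)
    toList {x} = ∈-filter⁺ P? (∈-allFin x)

    fromList : (_∈ S) ⊆ P
    fromList = proj₂ ∘ ∈-filter⁻ P? {xs = allFin (n G)}

    atLeastTwo : 2 ≤ length S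
    atLeastTwo = ≰⇒> (λ S≤1 → u₀≢u₁ (∈-length≤1 S≤1 (toList Pu₀) (toList Pu₁)))

-- From here on ∈ is membership in a Subset, no longer in a List.
open import Data.Fin.Subset using (_∈_; _∉_)

∣p∪q∣≤∣p∣+∣q∣ : ∀ {m} (p q : Subset m) → ∣ p ∪ q ∣ ≤ ∣ p ∣ + ∣ q ∣
∣p∪q∣≤∣p∣+∣q∣ []            []            = z≤n
∣p∪q∣≤∣p∣+∣q∣ (inside ∷ p)  (s ∷ q)       =
  s≤s (≤-trans (∣p∪q∣≤∣p∣+∣q∣ p q) (+-monoʳ-≤ ∣ p ∣ (∣p∣≤∣x∷p∣ s q)))
∣p∪q∣≤∣p∣+∣q∣ (outside ∷ p) (inside ∷ q)  =
  ≤-trans (s≤s (∣p∪q∣≤∣p∣+∣q∣ p q)) (≤-reflexive (≡.sym (+-suc ∣ p ∣ ∣ q ∣)))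
∣p∪q∣≤∣p∣+∣q∣ (outside ∷ p) (outside ∷ q) = ∣p∪q∣≤∣p∣+∣q∣ p q

∣p∣≥1⇒nonempty : ∀ {m} (p : Subset m) → 1 ≤ ∣ p ∣ → Nonempty p
∣p∣≥1⇒nonempty (inside ∷ p)  _     = zero , here
∣p∣≥1⇒nonempty (outside ∷ p) 1≤∣p∣ = let x , x∈p = ∣p∣≥1⇒nonempty p 1≤∣p∣ in suc x , there x∈p

∣p∣≥2⇒twoElements : ∀ {m} (p : Subset m) → 2 ≤ ∣ p ∣ → ∃₂ λ x y → x ∈ p × y ∈ p × x ≢ y
∣p∣≥2⇒twoElements (inside ∷ p) (s≤s 1≤∣p∣) =
  let y , y∈p = ∣p∣≥1⇒nonempty p 1≤∣p∣ in zero , suc y , here , there y∈p , λ ()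
∣p∣≥2⇒twoElements (outside ∷ p) 2≤∣p∣ =
  let x , y , x∈p , y∈p , x≢y = ∣p∣≥2⇒twoElements p 2≤∣p∣ in
  suc x , suc y , there x∈p , there y∈p , x≢y ∘ suc-injective

1<∣⁅u⁆∪⁅v⁆∣ : ∀ {m} {u v : Fin m} → u ≢ v → 1 < ∣ ⁅ u ⁆ ∪ ⁅ v ⁆ ∣
1<∣⁅u⁆∪⁅v⁆∣ {u = u} {v} u≢v = subst (_< ∣ ⁅ u ⁆ ∪ ⁅ v ⁆ ∣) (∣⁅x⁆∣≡1 u) (p⊂q⇒∣p∣<∣q∣ ⁅u⁆⊂pair)
  where
  ⁅u⁆⊂pair : ⁅ u ⁆ ⊂ ⁅ u ⁆ ∪ ⁅ v ⁆
  ⁅u⁆⊂pair = p⊆p∪q ⁅ v ⁆ , v , x∈p∪q⁺ (inj₂ (x∈⁅x⁆ v)) , x≢y⇒x∉⁅y⁆ (u≢v ∘ ≡.sym)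

⁅u⁆∪⁅v⁆≢⊤ : ∀ {m} (u v : Fin m) → 3 ≤ m → ⁅ u ⁆ ∪ ⁅ v ⁆ ≢ ⊤
⁅u⁆∪⁅v⁆≢⊤ {m} u v 3≤m pair≡⊤ = <⇒≱ 3≤m m≤2
  where
  open ≤-Reasoning
  m≤2 : m ≤ 2
  m≤2 = begin
    m                     ≡⟨ ∣⊤∣≡n m ⟨
    ∣ ⊤ {m} ∣             ≡⟨ cong ∣_∣ pair≡⊤ ⟨
    ∣ ⁅ u ⁆ ∪ ⁅ v ⁆ ∣     ≤⟨ ∣p∪q∣≤∣p∣+∣q∣ ⁅ u ⁆ ⁅ v ⁆ ⟩
    ∣ ⁅ u ⁆ ∣ + ∣ ⁅ v ⁆ ∣ ≡⟨ cong₂ _+_ (∣⁅x⁆∣≡1 u) (∣⁅x⁆∣≡1 v) ⟩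
    2                     ∎

allOrNone : ∀ G {M x} b → (∀ y → y ∈ M → adj G x y ≡ b) →
            (∀ y → y ∈ M → adj G x y ≡ true) ⊎ (∀ y → y ∈ M → adj G x y ≡ false)
allOrNone _ true  = inj₁
allOrNone _ false = inj₂

twins⇒pairModule : ∀ G {u v} → Twins G u v → IsModule G (⁅ u ⁆ ∪ ⁅ v ⁆)
twins⇒pairModule G {u} {v} (_ , same) x x∉ = allOrNone G (adj G x u) adjPair
  where
  x≢u : x ≢ u
  x≢u refl = x∉ (x∈p∪q⁺ (inj₁ (x∈⁅x⁆ u)))

  x≢v : x ≢ v
  x≢v refl = x∉ (x∈p∪q⁺ {p = ⁅ u ⁆} (inj₂ (x∈⁅x⁆ v)))

  adjPair : ∀ y → y ∈ ⁅ u ⁆ ∪ ⁅ v ⁆ → adj G x y ≡ adj G x u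
  adjPair y y∈ with x∈p∪q⁻ ⁅ u ⁆ ⁅ v ⁆ y∈
  ... | inj₁ y∈⁅u⁆ rewrite x∈⁅y⁆⇒x≡y u y∈⁅u⁆ = refl
  ... | inj₂ y∈⁅v⁆ rewrite x∈⁅y⁆⇒x≡y v y∈⁅v⁆ =
    trans (sym G x v) (trans (≡.sym (same x x≢u x≢v)) (sym G u x))

prime⇒twinFree : ∀ G → 3 ≤ n G → Prime G → TwinFree G
prime⇒twinFree G 3≤n prime u v twins@(u≢v , _) with prime _ (twins⇒pairModule G twins)
... | inj₁ ∣pair∣≤1 = <⇒≱ (1<∣⁅u⁆∪⁅v⁆∣ u≢v) ∣pair∣≤1
... | inj₂ pair≡⊤   = ⁅u⁆∪⁅v⁆≢⊤ u v 3≤n pair≡⊤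

distinctRows⇒injective : ∀ G {k} {H : Fin k → Fin k → Bool} (f : Fin k → Fin (n G)) →
                         (∀ i j → adj G (f i) (f j) ≡ H i j) →
                         (∀ i j → (∀ l → H i l ≡ H j l) → i ≡ j) → Injective _≡_ _≡_ f
distinctRows⇒injective G f f-adj rows {i} {j} fi≡fj = rows i j λ l →
  trans (≡.sym (f-adj i l)) (trans (cong (λ v → adj G v (f l)) fi≡fj) (f-adj j l))

gemAdj-rowsDistinct : ∀ i j → (∀ l → gemAdj i l ≡ gemAdj j l) → i ≡ j
gemAdj-rowsDistinct = from-yes (all? λ i → all? λ j → all? (λ l → gemAdj i l ≟ᵇ gemAdj j l) →-dec i ≟ j)

dominatedP₄⇒gem : ∀ G {x a b c d} → adj G x a ≡ true → adj G x b ≡ true → adj G x c ≡ true →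
                  adj G x d ≡ true → P₄ G false a b c d → ContainsInduced G 5 gemAdj
dominatedP₄⇒gem G {x} {a} {b} {c} {d} xa xb xc xd (ab , bc , cd , ac , bd , ad) =
  vertex , distinctRows⇒injective G vertex embeds gemAdj-rowsDistinct , embeds
  where
  vertex : Fin 5 → Fin (n G)
  vertex 0F = a
  vertex 1F = b
  vertex 2F = c
  vertex 3F = d
  vertex 4F = x

  embeds : ∀ i j → adj G (vertex i) (vertex j) ≡ gemAdj i j
  embeds 0F 0F = irrefl G a
  embeds 0F 1F = ab
  embeds 0F 2F = ac
  embeds 0F 3F = ad
  embeds 0F 4F = trans (sym G a x) xa
  embeds 1F 0F = trans (sym G b a) ab
  embeds 1F 1F = irrefl G b
  embeds 1F 2F = bc
  embeds 1F 3F = bd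
  embeds 1F 4F = trans (sym G b x) xb
  embeds 2F 0F = trans (sym G c a) ac
  embeds 2F 1F = trans (sym G c b) bc
  embeds 2F 2F = irrefl G c
  embeds 2F 3F = cd
  embeds 2F 4F = trans (sym G c x) xc
  embeds 3F 0F = trans (sym G d a) ad
  embeds 3F 1F = trans (sym G d b) bd
  embeds 3F 2F = trans (sym G d c) cd
  embeds 3F 3F = irrefl G d
  embeds 3F 4F = trans (sym G d x) xd
  embeds 4F 0F = xa
  embeds 4F 1F = xb
  embeds 4F 2F = xc
  embeds 4F 3F = xd
  embeds 4F 4F = irrefl G x

gemFree⇒neighbourhoodP₄Free : ∀ G → ¬ ContainsInduced G 5 gemAdj → ∀ x → P₄Free G (λ w → adj G x w ≡ true)
gemFree⇒neighbourhoodP₄Free G gemFree x xa xb xc xd = gemFree ∘ dominatedP₄⇒gem G xa xb xc xd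

boundaryEdge : ∀ G {M : Subset (n G)} {z y} → Star (λ a b → adj G a b ≡ true) z y → z ∉ M → y ∈ M →
               ∃₂ λ a b → a ∉ M × b ∈ M × adj G a b ≡ true
boundaryEdge G ε z∉ z∈ = ⊥-elim (z∉ z∈)
boundaryEdge G {M} (_◅_ {j = z′} zz′ path) z∉ y∈ with z′ ∈? M
... | yes z′∈ = _ , z′ , z∉ , z′∈ , zz′
... | no z′∉  = boundaryEdge G path z′∉ y∈

module-sameAdjacency : ∀ G {M y u w} → IsModule G M → y ∉ M → u ∈ M → w ∈ M → adj G y u ≡ adj G y w
module-sameAdjacency G mod y∉ u∈ w∈ with mod _ y∉
... | inj₁ all  = trans (all _ u∈) (≡.sym (all _ w∈))
... | inj₂ none = trans (none _ u∈) (≡.sym (none _ w∈))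

moduleTwins : ∀ G {M u w} → IsModule G M → u ∈ M → w ∈ M → TwinsIn G (_∈ M) u w → Twins G u w
moduleTwins G {M} {u} {w} mod u∈ w∈ (u≢w , same) = u≢w , same′
  where
  same′ : ∀ y → y ≢ u → y ≢ w → adj G u y ≡ adj G w y
  same′ y with y ∈? M
  ... | yes y∈ = same y∈
  ... | no y∉  = λ _ _ →
    trans (sym G u y) (trans (module-sameAdjacency G mod y∉ u∈ w∈) (sym G y w))

gemFreeModule⇒twins : ∀ G → Connected G → ¬ ContainsInduced G 5 gemAdj →
                      ∀ {M} → IsModule G M → 2 ≤ ∣ M ∣ → ∃ (_∉ M) → ∃₂ (Twins G)
gemFreeModule⇒twins G conn gemFree {M} mod 2≤∣M∣ (z , z∉) =
  let u₀ , u₁ , u₀∈ , u₁∈ , u₀≢u₁ = ∣p∣≥2⇒twoElements M 2≤∣M∣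
      x , y , x∉ , y∈ , xy = boundaryEdge G (conn z u₀) z∉ u₀∈
      x~M : (_∈ M) ⊆ (λ w → adj G x w ≡ true)
      x~M w∈ = trans (module-sameAdjacency G mod x∉ w∈ y∈) xy
      free : P₄Free G (_∈ M)
      free = P₄Free-⊆ G x~M (gemFree⇒neighbourhoodP₄Free G gemFree x)
      u , w , u∈ , w∈ , twins = P₄Free⇒twins G (_∈? M) free u₀∈ u₁∈ u₀≢u₁
  in u , w , moduleTwins G mod u∈ w∈ twins

twinFree⇒prime : ∀ G → Connected G → DistanceHereditary G → TwinFree G → Prime G
twinFree⇒prime G conn (_ , _ , _ , gemFree) twinFree M mod
  with ∣ M ∣ ≤? 1 | any? (λ z → ¬? (z ∈? M))
... | yes ∣M∣≤1 | _       = inj₁ ∣M∣≤1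
... | no ∣M∣≰1  | yes out =
  let u , w , twins = gemFreeModule⇒twins G conn gemFree mod (≰⇒> ∣M∣≰1) out in ⊥-elim (twinFree u w twins)
... | no _      | no ¬out =
  inj₂ (⊆-antisym ⊆⊤ λ {z} _ → decidable-stable (z ∈? M) (λ z∉ → ¬out (z , z∉)))

mainTheorem6 : (G : Graph) → 3 ≤ n G → Connected G → DistanceHereditary G →
    TwinFree G ⇔ Prime G
mainTheorem6 G 3≤n conn dh = mk⇔ (twinFree⇒prime G conn dh) (prime⇒twinFree G 3≤n)
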